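{- Let $G=(V,E)$ be a bipartite graph and let $M$ be a maximal matching of $G$. Let $p=\sqrt{2}-1$ and define the following random objects: - $M'\subseteq M$ contains each edge of $M$ independently with probability $p$; - $V'=V(M')$ and $U=V\setminus V(M)$; - $H=G[V',U]$; - $g=\mathbb{E}_\pi[|\mathrm{GMM}(H,\pi)|\mid M']$, where $\pi$ is a uniformly random permutation of the edges of $H$; - $\widetilde{\mu}'=|M|+\max\{0,\,g-|M'|\}$. Then with probability $1$ (over the choice of $M'$), $\widetilde{\mu}'\le\mu(G)$.
   Context: $\mu(G)$ is the maximum matching size of $G$. $V(M)$ is the set of vertices matched by $M$. For disjoint vertex sets $A,B$, $G[A,B]$ is the bipartite subgraph of $G$ consisting of all edges of $G$ with one endpoint in $A$ and the other in $B$. For a graph $H$ and a permutation $\pi$ of its edges, $\mathrm{GMM}(H,\pi)$ is the greedy maximal matching obtained by processing edges in order $\pi$ and adding each edge whose endpoints are both still unmatched. -}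

module Defs where

open import Data.Nat as ℕ using (ℕ; zero; suc)
open import Data.Bool using (Bool; true; false; if_then_else_; _∧_; _∨_; not)
open import Data.Fin using (Fin; _≟_)
open import Data.Product using (_×_; _,_; proj₁; proj₂; ∃; swap)
open import Data.Sum using (_⊎_)
open import Data.List using (List; []; _∷_; length; map; concatMap; foldr)
open import Data.Nat.ListAction using (sum)
open import Data.List.Relation.Unary.All using (All)
open import Data.List.Relation.Unary.AllPairs using (AllPairs)
open import Data.List.Membership.Propositional using (_∈_)
open import Relation.Nullary using (¬_; does)
open import Relation.Binary.PropositionalEquality using (_≡_; _≢_)
open import Data.Integer using (+_)
open import Data.Rational as ℚ using (ℚ)

bfilter : ∀ {A : Set} → (A → Bool) → List A → List A
bfilter p [] = []
bfilter p (x ∷ xs) = if p x then x ∷ bfilter p xs else bfilter p xs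

anyB : ∀ {A : Set} → (A → Bool) → List A → Bool
anyB p [] = false
anyB p (x ∷ xs) = p x ∨ anyB p xs

allB : ∀ {A : Set} → (A → Bool) → List A → Bool
allB p [] = true
allB p (x ∷ xs) = p x ∧ allB p xs

-- An edge {u,v} is represented by an ordered pair (u , v); vertices are Fin n.
Edge : ℕ → Set
Edge n = Fin n × Fin n

SameEdge : ∀ {n} → Edge n → Edge n → Set
SameEdge e f = e ≡ f ⊎ e ≡ swap f

record Graph (n : ℕ) : Set where
  field
    edges    : List (Edge n)
    loopless : All (λ e → proj₁ e ≢ proj₂ e) edges
    simple   : AllPairs (λ e f → ¬ SameEdge e f) edges
open Graph public

IsBipartite : ∀ {n} → Graph n → Set
IsBipartite {n} G = ∃ λ (c : Fin n → Bool) → All (λ e → c (proj₁ e) ≢ c (proj₂ e)) (edges G)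

covers : ∀ {n} → Fin n → Edge n → Bool
covers v (a , b) = does (v ≟ a) ∨ does (v ≟ b)

coveredBy : ∀ {n} → List (Edge n) → Fin n → Bool
coveredBy M v = anyB (covers v) M

disjointE : ∀ {n} → Edge n → Edge n → Bool
disjointE (a , b) f = not (covers a f ∨ covers b f)

isMatching : ∀ {n} → List (Edge n) → Bool
isMatching [] = true
isMatching (e ∷ es) = allB (disjointE e) es ∧ isMatching es

record IsMatching {n} (G : Graph n) (M : List (Edge n)) : Set where
  field
    inG      : All (_∈ edges G) M
    disjoint : isMatching M ≡ true

record IsMaximalMatching {n} (G : Graph n) (M : List (Edge n)) : Set where
  field
    matching : IsMatching G M
    maximal  : All (λ e → (coveredBy M (proj₁ e) ∨ coveredBy M (proj₂ e)) ≡ true) (edges G)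

sublists : ∀ {A : Set} → List A → List (List A)
sublists [] = [] ∷ []
sublists (x ∷ xs) = let s = sublists xs in map (x ∷_) s Data.List.++ s

maxList : List ℕ → ℕ
maxList = foldr ℕ._⊔_ 0

μ : ∀ {n} → Graph n → ℕ
μ G = maxList (map length (bfilter isMatching (sublists (edges G))))

-- G[V', U] with V' = V(M'), U = V \ V(M): edges with one endpoint in V', other in U
crossEdges : ∀ {n} → Graph n → (M M' : List (Edge n)) → List (Edge n)
crossEdges G M M' = bfilter ok (edges G)
  where
    inV' = coveredBy M'
    inU = λ x → not (coveredBy M x)
    ok = λ e → (inV' (proj₁ e) ∧ inU (proj₂ e)) ∨ (inV' (proj₂ e) ∧ inU (proj₁ e))

gmmAcc : ∀ {n} → List (Edge n) → List (Edge n) → List (Edge n)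
gmmAcc acc [] = acc
gmmAcc acc ((a , b) ∷ π) =
  if not (coveredBy acc a) ∧ not (coveredBy acc b)
  then gmmAcc ((a , b) ∷ acc) π else gmmAcc acc π

GMM : ∀ {n} → List (Edge n) → List (Edge n)
GMM π = gmmAcc [] π

insertions : ∀ {A : Set} → A → List A → List (List A)
insertions x [] = (x ∷ []) ∷ []
insertions x (y ∷ ys) = (x ∷ y ∷ ys) ∷ map (y ∷_) (insertions x ys)

permutations : ∀ {A : Set} → List A → List (List A)
permutations [] = [] ∷ []
permutations (x ∷ xs) = concatMap (insertions x) (permutations xs)

-- uniform average of a list of naturals (0 for the empty list)
average : List ℕ → ℚ
average [] = ℚ.0ℚ
average (x ∷ xs) = (+ sum (x ∷ xs)) ℚ./ length (x ∷ xs)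

toℚ : ℕ → ℚ
toℚ k = (+ k) ℚ./ 1

-- g = E_π[ |GMM(H, π)| ] for π uniform over orderings of the edges of H
gExp : ∀ {n} → List (Edge n) → ℚ
gExp H = average (map (λ π → length (GMM π)) (permutations H))

μ̃' : ∀ {n} → Graph n → (M M' : List (Edge n)) → ℚ
μ̃' G M M' = toℚ (length M) ℚ.+ (ℚ.0ℚ ℚ.⊔ (gExp (crossEdges G M M') ℚ.- toℚ (length M')))

-- Every greedy matching A of H = G[V(M'), U] is a matching of G whose edges join V(M') to vertices
-- left unmatched by M. An edge ab of M' whose endpoints are both matched by A, to u and u', yields
-- the augmenting path u a b u' for M, and these paths are vertex-disjoint; if k edges of M' are of
-- this kind, then μ(G) ≥ |M| + k. Each vertex meets at most one edge of A, so |A| ≤ |M'| + k, hence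
-- |M| + |A| − |M'| ≤ μ(G) for every ordering of the edges of H, and averaging gives g − |M'| ≤ μ(G) − |M|.
-- With |M| ≤ μ(G) this bounds μ̃' for every M' ⊆ M.
module Submission where

open import Defs
open import Data.Bool using (Bool; true; false; _∧_; _∨_; not)
open import Data.Bool.Properties using (T-≡)
open import Data.Empty using (⊥-elim)
open import Data.Fin using (Fin; _≟_)
open import Data.List using (List; []; _∷_; length; map; filter; filterᵇ)
open import Data.List.Properties using (filter-all; filter-accept; filter-reject; length-removeAt′)
open import Data.List.Membership.Propositional using (_∈_; find; lose)
open import Data.List.Membership.Propositional.Properties
  using (∈-++⁺ˡ; ∈-++⁺ʳ; ∈-map⁺; ∈-map⁻; ∈-filter⁺; ∈-filter⁻; ∈-concatMap⁻)
import Data.List.Membership.DecPropositional as DecMembership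
open import Data.List.Relation.Unary.All as All using (All; []; _∷_)
import Data.List.Relation.Unary.All.Properties as Allₚ
open Allₚ using (¬Any⇒All¬)
open import Data.List.Relation.Unary.Any using (Any; here; there; any?; index; _─_)
open import Data.List.Relation.Unary.AllPairs as AllPairs using (AllPairs; []; _∷_; allPairs?)
import Data.List.Relation.Unary.AllPairs.Properties as AllPairsₚ
open import Data.List.Relation.Unary.Unique.Propositional using (Unique)
open import Data.List.Relation.Binary.Permutation.Propositional using (_↭_; prep; swap; ↭-refl; ↭-trans)
open import Data.List.Relation.Binary.Permutation.Propositional.Properties using (∈-resp-↭)
open import Data.List.Relation.Binary.Sublist.Propositional using (_⊆_; []; _∷_; _∷ʳ_)
open import Data.List.Relation.Binary.Sublist.Propositional.Properties using (All-resp-⊆; Any-resp-⊆; filter-⊆)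
open import Data.Nat as ℕ using (ℕ; suc; _+_; _∸_; _≤_; z≤n; s≤s)
open import Data.Nat.ListAction using (sum)
open import Data.Nat.Properties as ℕₚ
  using (≤-trans; ≤-reflexive; +-identityʳ; +-suc; +-monoʳ-≤; +-mono-≤; m≤m⊔n; m≤n⊔m; module ≤-Reasoning)
open import Data.Integer as ℤ using (+_)
import Data.Integer.Properties as ℤₚ
import Data.Rational as ℚ
import Data.Rational.Properties as ℚₚ
import Data.Rational.Unnormalised as ℚᵘ
import Data.Rational.Unnormalised.Properties as ℚᵘₚ
open import Data.Product using (_×_; _,_; proj₁; proj₂)
open import Data.Product.Properties using (≡-dec)
open import Data.Sum using (_⊎_; inj₁; inj₂; [_,_]; map₂)
open import Function using (_∘_; _$_; id; Equivalence)
open import Relation.Nullary using (¬_; Dec; yes; no; does; ¬?; _⊎-dec_; _×-dec_; T?)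
open import Relation.Nullary.Decidable using (map′; dec-true)
open import Relation.Unary using (Decidable)
open import Relation.Binary.PropositionalEquality using (_≡_; _≢_; refl; sym; trans; cong; cong₂; subst; subst₂)

module _ {A : Set} where

  bfilter≡filterᵇ : ∀ (p : A → Bool) xs → bfilter p xs ≡ filterᵇ p xs
  bfilter≡filterᵇ p [] = refl
  bfilter≡filterᵇ p (x ∷ xs) with p x
  ... | true  = cong (x ∷_) (bfilter≡filterᵇ p xs)
  ... | false = bfilter≡filterᵇ p xs

  ∈-bfilter⁻ : ∀ (p : A → Bool) xs {x} → x ∈ bfilter p xs → x ∈ xs × p x ≡ true
  ∈-bfilter⁻ p xs x∈ =
    let x∈xs , px = ∈-filter⁻ (T? ∘ p) (subst (_ ∈_) (bfilter≡filterᵇ p xs) x∈) in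
    x∈xs , Equivalence.to T-≡ px

  ∈-bfilter⁺ : ∀ (p : A → Bool) {xs x} → x ∈ xs → p x ≡ true → x ∈ bfilter p xs
  ∈-bfilter⁺ p {xs} x∈xs px =
    subst (_ ∈_) (sym (bfilter≡filterᵇ p xs)) (∈-filter⁺ (T? ∘ p) x∈xs (Equivalence.from T-≡ px))

  module _ {P : A → Set} (P? : Decidable P) where

    anyB-any? : ∀ xs → anyB (does ∘ P?) xs ≡ does (any? P? xs)
    anyB-any? []       = refl
    anyB-any? (x ∷ xs) = cong (does (P? x) ∨_) (anyB-any? xs)

    allB-all? : ∀ xs → allB (does ∘ P?) xs ≡ does (All.all? P? xs)
    allB-all? []       = refl
    allB-all? (x ∷ xs) = cong (does (P? x) ∧_) (allB-all? xs)

  ∈-─ : ∀ {x y : A} {xs} (x∈xs : x ∈ xs) → y ∈ xs → y ≢ x → y ∈ (xs ─ x∈xs)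
  ∈-─ (here refl) (here refl) y≢x = ⊥-elim (y≢x refl)
  ∈-─ (here refl) (there y∈)  _   = y∈
  ∈-─ (there x∈)  (here refl) _   = here refl
  ∈-─ (there x∈)  (there y∈)  y≢x = there (∈-─ x∈ y∈ y≢x)

  Unique-⊆ₛ⇒length-≤ : ∀ {xs ys : List A} → Unique xs → (∀ {x} → x ∈ xs → x ∈ ys) → length xs ≤ length ys
  Unique-⊆ₛ⇒length-≤ {[]}     _          _   = z≤n
  Unique-⊆ₛ⇒length-≤ {x ∷ xs} {ys} (x∉ ∷ xs!) sub = begin
    suc (length xs)          ≤⟨ s≤s (Unique-⊆ₛ⇒length-≤ xs! sub′) ⟩
    suc (length (ys ─ x∈ys)) ≡⟨ length-removeAt′ ys (index x∈ys) ⟨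
    length ys                ∎
    where
      open ≤-Reasoning
      x∈ys = sub (here refl)
      sub′ : ∀ {y} → y ∈ xs → y ∈ (ys ─ x∈ys)
      sub′ y∈ = ∈-─ x∈ys (sub (there y∈)) (λ y≡x → All.lookup x∉ y∈ (sym y≡x))

  Unique⇒AllPairs : ∀ {R : A → A → Set} {xs ys} → (∀ {x y} → x ∈ ys → y ∈ ys → x ≢ y → R x y) →
                    (∀ {x} → x ∈ xs → x ∈ ys) → Unique xs → AllPairs R xs
  Unique⇒AllPairs R≢ sub []         = []
  Unique⇒AllPairs R≢ sub (x∉ ∷ xs!) =
    All.tabulate (λ y∈ → R≢ (sub (here refl)) (sub (there y∈)) (All.lookup x∉ y∈)) ∷
    Unique⇒AllPairs R≢ (sub ∘ there) xs!

  AllPairs-resp-⊆ : ∀ {R : A → A → Set} {xs ys} → xs ⊆ ys → AllPairs R ys → AllPairs R xs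
  AllPairs-resp-⊆ []         []         = []
  AllPairs-resp-⊆ (_ ∷ʳ s)   (_ ∷ ys!)  = AllPairs-resp-⊆ s ys!
  AllPairs-resp-⊆ (refl ∷ s) (y# ∷ ys!) = All-resp-⊆ s y# ∷ AllPairs-resp-⊆ s ys!

  ⊆⇒∈-sublists : ∀ {xs ys : List A} → xs ⊆ ys → xs ∈ sublists ys
  ⊆⇒∈-sublists []                      = here refl
  ⊆⇒∈-sublists {ys = y ∷ ys} (y ∷ʳ s)   = ∈-++⁺ʳ (map (y ∷_) (sublists ys)) (⊆⇒∈-sublists s)
  ⊆⇒∈-sublists (refl ∷ s)               = ∈-++⁺ˡ (∈-map⁺ (_ ∷_) (⊆⇒∈-sublists s))

  insertions-↭ : ∀ {x : A} xs {ys} → ys ∈ insertions x xs → ys ↭ x ∷ xs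
  insertions-↭ []       (here refl) = ↭-refl
  insertions-↭ (y ∷ xs) (here refl) = ↭-refl
  insertions-↭ {x} (y ∷ xs) (there ys∈) with zs , zs∈ , refl ← ∈-map⁻ (y ∷_) ys∈ =
    ↭-trans (prep y (insertions-↭ xs zs∈)) (swap y x ↭-refl)

  permutations-↭ : ∀ (xs : List A) {ys} → ys ∈ permutations xs → ys ↭ xs
  permutations-↭ []       (here refl) = ↭-refl
  permutations-↭ (x ∷ xs) ys∈ with zs , zs∈ , ys∈zs ← find (∈-concatMap⁻ (insertions x) ys∈) =
    ↭-trans (insertions-↭ zs ys∈zs) (prep x (permutations-↭ xs zs∈))

true⇒witness : ∀ {P : Set} (P? : Dec P) → does P? ≡ true → P
true⇒witness (yes p) _  = p
true⇒witness (no _)  ()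

∈⇒≤-maxList : ∀ {k ks} → k ∈ ks → k ≤ maxList ks
∈⇒≤-maxList (here refl) = m≤m⊔n _ _
∈⇒≤-maxList (there k∈)  = ≤-trans (∈⇒≤-maxList k∈) (m≤n⊔m _ _)

-- Matchings

module _ {n : ℕ} where

  infix 4 _∈ₑ_ _∈ₑ?_ _∈ᵥ_ _∈ᵥ?_

  _∈ₑ_ : Fin n → Edge n → Set
  v ∈ₑ (a , b) = v ≡ a ⊎ v ≡ b

  _∈ₑ?_ : ∀ v e → Dec (v ∈ₑ e)
  v ∈ₑ? (a , b) = v ≟ a ⊎-dec v ≟ b

  _∈ᵥ_ : Fin n → List (Edge n) → Set
  v ∈ᵥ M = Any (v ∈ₑ_) M

  _∈ᵥ?_ : ∀ v M → Dec (v ∈ᵥ M)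
  v ∈ᵥ? M = any? (v ∈ₑ?_) M

  coveredBy-does : ∀ M v → coveredBy M v ≡ does (v ∈ᵥ? M)
  coveredBy-does M v = anyB-any? (v ∈ₑ?_) M

  Disjoint : Edge n → Edge n → Set
  Disjoint e f = ∀ {v} → v ∈ₑ e → ¬ v ∈ₑ f

  disjoint? : ∀ e f → Dec (Disjoint e f)
  disjoint? (a , b) f = map′ to from (¬? (a ∈ₑ? f ⊎-dec b ∈ₑ? f))
    where
      to : ¬ (a ∈ₑ f ⊎ b ∈ₑ f) → Disjoint (a , b) f
      to ¬ab (inj₁ refl) = ¬ab ∘ inj₁
      to ¬ab (inj₂ refl) = ¬ab ∘ inj₂
      from : Disjoint (a , b) f → ¬ (a ∈ₑ f ⊎ b ∈ₑ f)
      from d = [ d (inj₁ refl) , d (inj₂ refl) ]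

  isMatching-does : ∀ M → isMatching M ≡ does (allPairs? disjoint? M)
  isMatching-does []      = refl
  isMatching-does (e ∷ M) = cong₂ _∧_ (allB-all? (disjoint? e) M) (isMatching-does M)

  Disjoint-irrefl : ∀ {e} → ¬ Disjoint e e
  Disjoint-irrefl d = d (inj₁ refl) (inj₁ refl)

  record Matching (G : Graph n) (M : List (Edge n)) : Set where
    constructor mkMatching
    field
      inG      : All (_∈ edges G) M
      pairwise : AllPairs Disjoint M

  IsMatching⇒Matching : ∀ {G M} → IsMatching G M → Matching G M
  IsMatching⇒Matching {M = M} m =
    mkMatching (IsMatching.inG m) $
      true⇒witness (allPairs? disjoint? M) (trans (sym (isMatching-does M)) (IsMatching.disjoint m))

  shared-endpoint⇒≡ : ∀ {M e f v} → AllPairs Disjoint M → e ∈ M → f ∈ M → v ∈ₑ e → v ∈ₑ f → e ≡ f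
  shared-endpoint⇒≡ (_ ∷ _)  (here refl) (here refl) _   _   = refl
  shared-endpoint⇒≡ (e# ∷ _) (here refl) (there f∈)  v∈e v∈f = ⊥-elim (All.lookup e# f∈ v∈e v∈f)
  shared-endpoint⇒≡ (f# ∷ _) (there e∈)  (here refl) v∈e v∈f = ⊥-elim (All.lookup f# e∈ v∈f v∈e)
  shared-endpoint⇒≡ (_ ∷ M!) (there e∈)  (there f∈)  v∈e v∈f = shared-endpoint⇒≡ M! e∈ f∈ v∈e v∈f

  Disjoint⇒Unique : ∀ {M} → AllPairs Disjoint M → Unique M
  Disjoint⇒Unique = AllPairs.map λ { d refl → Disjoint-irrefl d }

  edges-unique : ∀ (G : Graph n) → Unique (edges G)
  edges-unique G = AllPairs.map (λ ¬same → ¬same ∘ inj₁) (simple G)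

  open DecMembership (≡-dec (_≟_ {n}) (_≟_ {n})) using (_∈?_)

  -- μ G only ranges over sublists of edges G, so L is traded for the sublist of edges G with the same elements.
  Matching⇒≤μ : ∀ {G L} → Matching G L → length L ≤ μ G
  Matching⇒≤μ {G} {L} (mkMatching L⊆G L!) = begin
    length L ≤⟨ Unique-⊆ₛ⇒length-≤ (Disjoint⇒Unique L!) L⊆S ⟩
    length S ≤⟨ ∈⇒≤-maxList (∈-map⁺ length S∈) ⟩
    μ G      ∎
    where
      open ≤-Reasoning
      S = filter (_∈? L) (edges G)
      L⊆S : ∀ {e} → e ∈ L → e ∈ S
      L⊆S e∈ = ∈-filter⁺ (_∈? L) (All.lookup L⊆G e∈) e∈
      S! : AllPairs Disjoint S
      S! = Unique⇒AllPairs (λ e∈ f∈ e≢f v∈e v∈f → e≢f (shared-endpoint⇒≡ L! e∈ f∈ v∈e v∈f))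
             (proj₂ ∘ ∈-filter⁻ (_∈? L) {xs = edges G}) (AllPairsₚ.filter⁺ (_∈? L) (edges-unique G))
      S∈ : S ∈ bfilter isMatching (sublists (edges G))
      S∈ = ∈-bfilter⁺ isMatching {sublists (edges G)} (⊆⇒∈-sublists (filter-⊆ (_∈? L) (edges G)))
             (trans (isMatching-does S) (dec-true (allPairs? disjoint? S) S!))

-- Greedy matchings

module _ {n : ℕ} where

  uncovered⇒All-Disjoint : ∀ {a b : Fin n} {M} → ¬ a ∈ᵥ M → ¬ b ∈ᵥ M → All (Disjoint (a , b)) M
  uncovered⇒All-Disjoint a∉ b∉ = All.tabulate λ where
    f∈ (inj₁ refl) v∈f → a∉ (lose f∈ v∈f)
    f∈ (inj₂ refl) v∈f → b∉ (lose f∈ v∈f)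

  gmmAcc-⊆ : ∀ (acc π : List (Edge n)) {e} → e ∈ gmmAcc acc π → e ∈ acc ⊎ e ∈ π
  gmmAcc-⊆ acc [] e∈ = inj₁ e∈
  gmmAcc-⊆ acc ((a , b) ∷ π) e∈ with not (coveredBy acc a) ∧ not (coveredBy acc b)
  ... | false = map₂ there (gmmAcc-⊆ acc π e∈)
  ... | true with gmmAcc-⊆ ((a , b) ∷ acc) π e∈
  ...   | inj₁ (here refl)  = inj₂ (here refl)
  ...   | inj₁ (there e∈acc) = inj₁ e∈acc
  ...   | inj₂ e∈π           = inj₂ (there e∈π)

  gmmAcc-pairwise : ∀ (acc π : List (Edge n)) → AllPairs Disjoint acc → AllPairs Disjoint (gmmAcc acc π)
  gmmAcc-pairwise acc [] acc! = acc!
  gmmAcc-pairwise acc ((a , b) ∷ π) acc!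
    rewrite coveredBy-does acc a | coveredBy-does acc b with a ∈ᵥ? acc | b ∈ᵥ? acc
  ... | no a∉ | no b∉ = gmmAcc-pairwise ((a , b) ∷ acc) π (uncovered⇒All-Disjoint a∉ b∉ ∷ acc!)
  ... | no _  | yes _ = gmmAcc-pairwise acc π acc!
  ... | yes _ | _     = gmmAcc-pairwise acc π acc!

  GMM-⊆ : ∀ (π : List (Edge n)) {e} → e ∈ GMM π → e ∈ π
  GMM-⊆ π = [ (λ ()) , id ] ∘ gmmAcc-⊆ [] π

  GMM-pairwise : ∀ (π : List (Edge n)) → AllPairs Disjoint (GMM π)
  GMM-pairwise π = gmmAcc-pairwise [] π []

-- Crossing edges and augmenting paths

module _ {n : ℕ} where

  -- For R = M′ these are the edges of H = G[V(M′), U].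
  Crossing : (M R : List (Edge n)) → Edge n → Set
  Crossing M R (a , b) = (a ∈ᵥ R × ¬ b ∈ᵥ M) ⊎ (b ∈ᵥ R × ¬ a ∈ᵥ M)

  crossing? : ∀ M R e → Dec (Crossing M R e)
  crossing? M R (a , b) = (a ∈ᵥ? R ×-dec ¬? (b ∈ᵥ? M)) ⊎-dec (b ∈ᵥ? R ×-dec ¬? (a ∈ᵥ? M))

  ∈-crossEdges : ∀ {G M R e} → e ∈ crossEdges G M R → e ∈ edges G × Crossing M R e
  ∈-crossEdges {G} {M} {R} {a , b} e∈ =
    let e∈G , ok = ∈-bfilter⁻ _ (edges G) e∈ in
    e∈G , true⇒witness (crossing? M R (a , b)) (trans (sym ok-does) ok)
    where
      ok-does : (coveredBy R a ∧ not (coveredBy M b)) ∨ (coveredBy R b ∧ not (coveredBy M a))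
                ≡ does (crossing? M R (a , b))
      ok-does rewrite coveredBy-does R a | coveredBy-does M b | coveredBy-does R b | coveredBy-does M a = refl

  ¬Crossing-[] : ∀ {M e} → ¬ Crossing M [] e
  ¬Crossing-[] (inj₁ (() , _))
  ¬Crossing-[] (inj₂ (() , _))

  Crossing-mono : ∀ {M M′ R R′ e} → (∀ {x} → x ∈ₑ e → x ∈ᵥ R → x ∈ᵥ R′) →
                  (∀ {y} → y ∈ₑ e → ¬ y ∈ᵥ M → ¬ y ∈ᵥ M′) → Crossing M R e → Crossing M′ R′ e
  Crossing-mono f g (inj₁ (a∈ , b∉)) = inj₁ (f (inj₁ refl) a∈ , g (inj₂ refl) b∉)
  Crossing-mono f g (inj₂ (b∈ , a∉)) = inj₂ (f (inj₂ refl) b∈ , g (inj₁ refl) a∉)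

  Crossing-covered⇒≡ : ∀ {M R e x y} → Crossing M R e → x ∈ₑ e → y ∈ₑ e → x ∈ᵥ M → y ∈ᵥ M → x ≡ y
  Crossing-covered⇒≡ (inj₁ _)        (inj₁ refl) (inj₁ refl) _  _  = refl
  Crossing-covered⇒≡ (inj₁ (_ , b∉)) (inj₂ refl) _           x∈ _  = ⊥-elim (b∉ x∈)
  Crossing-covered⇒≡ (inj₁ (_ , b∉)) _           (inj₂ refl) _  y∈ = ⊥-elim (b∉ y∈)
  Crossing-covered⇒≡ (inj₂ _)        (inj₂ refl) (inj₂ refl) _  _  = refl
  Crossing-covered⇒≡ (inj₂ (_ , a∉)) (inj₁ refl) _           x∈ _  = ⊥-elim (a∉ x∈)
  Crossing-covered⇒≡ (inj₂ (_ , a∉)) _           (inj₁ refl) _  y∈ = ⊥-elim (a∉ y∈)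

  avoid : Fin n → List (Edge n) → List (Edge n)
  avoid v = filter (λ e → ¬? (v ∈ₑ? e))

  ∈-avoid⁺ : ∀ {v e A} → e ∈ A → ¬ v ∈ₑ e → e ∈ avoid v A
  ∈-avoid⁺ {v} = ∈-filter⁺ (λ e → ¬? (v ∈ₑ? e))

  ∈-avoid⁻ : ∀ {v e} A → e ∈ avoid v A → e ∈ A × ¬ v ∈ₑ e
  ∈-avoid⁻ {v} A = ∈-filter⁻ (λ e → ¬? (v ∈ₑ? e)) {xs = A}

  avoid-∉ : ∀ {v A} → ¬ v ∈ᵥ A → avoid v A ≡ A
  avoid-∉ {v} {A} v∉ = filter-all (λ e → ¬? (v ∈ₑ? e)) (¬Any⇒All¬ A v∉)

  length-avoid-∉ : ∀ {v A} → ¬ v ∈ᵥ A → length A ≤ length (avoid v A)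
  length-avoid-∉ v∉ = ≤-reflexive (cong length (sym (avoid-∉ v∉)))

  length-avoid : ∀ {v A} → AllPairs Disjoint A → length A ≤ suc (length (avoid v A))
  length-avoid [] = z≤n
  length-avoid {v} {e ∷ A} (e# ∷ A!) with v ∈ₑ? e
  ... | yes v∈e = subst (λ xs → suc (length A) ≤ suc (length xs))
                        (sym (filter-reject (λ e → ¬? (v ∈ₑ? e)) (λ v∉e → v∉e v∈e)))
                        (s≤s (length-avoid-∉ v∉A))
    where
      v∉A : ¬ v ∈ᵥ A
      v∉A v∈A = let f , f∈ , v∈f = find v∈A in All.lookup e# f∈ v∈e v∈f
  ... | no v∉e = subst (λ xs → suc (length A) ≤ suc (length xs))
                       (sym (filter-accept (λ e → ¬? (v ∈ₑ? e)) v∉e)) (s≤s (length-avoid A!))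

  avoid-matching : ∀ {G v A} → Matching G A → Matching G (avoid v A)
  avoid-matching {v = v} (mkMatching A⊆G A!) =
    mkMatching (Allₚ.filter⁺ (λ e → ¬? (v ∈ₑ? e)) A⊆G) (AllPairsₚ.filter⁺ _ A!)

  ∈-avoid₂⁻ : ∀ {a b e} A → e ∈ avoid b (avoid a A) → e ∈ A × ¬ a ∈ₑ e × ¬ b ∈ₑ e
  ∈-avoid₂⁻ A e∈ =
    let e∈A₁ , b∉e = ∈-avoid⁻ (avoid _ A) e∈ ; e∈A , a∉e = ∈-avoid⁻ A e∈A₁ in e∈A , a∉e , b∉e

  avoid₂-crossing : ∀ {M N R A a b} → All (Crossing M ((a , b) ∷ R)) A →
                    (∀ {e y} → e ∈ avoid b (avoid a A) → y ∈ₑ e → ¬ y ∈ᵥ M → ¬ y ∈ᵥ N) →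
                    All (Crossing N R) (avoid b (avoid a A))
  avoid₂-crossing {M} {N} {R} {A} {a} {b} cross keep = All.tabulate λ e∈ →
    let e∈A , a∉e , b∉e = ∈-avoid₂⁻ A e∈ in Crossing-mono (drop-ab a∉e b∉e) (keep e∈) (All.lookup cross e∈A)
    where
      drop-ab : ∀ {e x} → ¬ a ∈ₑ e → ¬ b ∈ₑ e → x ∈ₑ e → x ∈ᵥ (a , b) ∷ R → x ∈ᵥ R
      drop-ab a∉e _   x∈e (here (inj₁ refl)) = ⊥-elim (a∉e x∈e)
      drop-ab _   b∉e x∈e (here (inj₂ refl)) = ⊥-elim (b∉e x∈e)
      drop-ab _   _   _   (there x∈R)         = x∈R

  augment : ∀ {G M A R a b e₁ e₂} → Matching G M → (a , b) ∈ M → Matching G A → All (Crossing M R) A →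
            e₁ ∈ A → a ∈ₑ e₁ → e₂ ∈ avoid a A → b ∈ₑ e₂ → Matching G (e₁ ∷ e₂ ∷ avoid a M)
  augment {M = M} {A} {a = a} {b} {e₁} {e₂} (mkMatching M⊆G M!) m∈M (mkMatching A⊆G A!) cross
          e₁∈A a∈e₁ e₂∈A₁ b∈e₂ =
    mkMatching (All.lookup A⊆G e₁∈A ∷ All.lookup A⊆G e₂∈A ∷ Allₚ.filter⁺ _ M⊆G)
               ((e₁#e₂ ∷ fresh e₁∈A (inj₁ refl) a∈e₁) ∷ fresh e₂∈A (inj₂ refl) b∈e₂ ∷ AllPairsₚ.filter⁺ _ M!)
    where
      e₂∈A : e₂ ∈ A
      e₂∈A = proj₁ (∈-avoid⁻ A e₂∈A₁)
      e₁#e₂ : Disjoint e₁ e₂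
      e₁#e₂ v∈e₁ v∈e₂ =
        proj₂ (∈-avoid⁻ A e₂∈A₁) (subst (a ∈ₑ_) (shared-endpoint⇒≡ A! e₁∈A e₂∈A v∈e₁ v∈e₂) a∈e₁)
      fresh : ∀ {e x} → e ∈ A → x ∈ₑ (a , b) → x ∈ₑ e → All (Disjoint e) (avoid a M)
      fresh e∈A x∈m x∈e = All.tabulate λ {f} f∈ {v} v∈e v∈f →
        let f∈M , a∉f = ∈-avoid⁻ M f∈
            v≡x = Crossing-covered⇒≡ (All.lookup cross e∈A) v∈e x∈e (lose f∈M v∈f) (lose m∈M x∈m)
        in a∉f (subst (a ∈ₑ_) (shared-endpoint⇒≡ M! m∈M f∈M x∈m (subst (_∈ₑ f) v≡x v∈f)) (inj₁ refl))

  augment-uncovered : ∀ {M A a b e₁ e₂ e y} → AllPairs Disjoint A → e₁ ∈ A → a ∈ₑ e₁ → e₂ ∈ A → b ∈ₑ e₂ →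
                      e ∈ avoid b (avoid a A) → y ∈ₑ e → ¬ y ∈ᵥ M → ¬ y ∈ᵥ (e₁ ∷ e₂ ∷ avoid a M)
  augment-uncovered {M} {A} {a} {b} A! e₁∈A a∈e₁ e₂∈A b∈e₂ e∈ y∈e y∉M = λ where
      (here y∈e₁)         → a∉e (subst (a ∈ₑ_) (shared-endpoint⇒≡ A! e₁∈A e∈A y∈e₁ y∈e) a∈e₁)
      (there (here y∈e₂)) → b∉e (subst (b ∈ₑ_) (shared-endpoint⇒≡ A! e₂∈A e∈A y∈e₂ y∈e) b∈e₂)
      (there (there y∈M)) → y∉M (Any-resp-⊆ (filter-⊆ (λ e → ¬? (a ∈ₑ? e)) M) y∈M)
    where
      e∈A = proj₁ (∈-avoid₂⁻ A e∈)
      a∉e = proj₁ (proj₂ (∈-avoid₂⁻ A e∈))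
      b∉e = proj₂ (proj₂ (∈-avoid₂⁻ A e∈))

  -- R is the part of M′ still to be processed and M the matching augmented so far. A step drops an edge ab
  -- from R and the edges of A at a and b; when there are two of them, they replace ab in M.
  crossing-matching-bound : ∀ {G M A} R → Matching G M → Matching G A → All (_∈ M) R → AllPairs Disjoint R →
                            All (Crossing M R) A → length M + length A ≤ μ G + length R
  crossing-matching-bound {G} {M} [] M-m _ _ _ [] = begin
    length M + 0 ≡⟨ +-identityʳ _ ⟩
    length M     ≤⟨ Matching⇒≤μ M-m ⟩
    μ G          ≡⟨ +-identityʳ _ ⟨
    μ G + 0      ∎
    where open ≤-Reasoning
  crossing-matching-bound [] _ _ _ _ (c ∷ _) = ⊥-elim (¬Crossing-[] c)
  crossing-matching-bound {G} {M} {A} ((a , b) ∷ R) M-m A-m (m∈M ∷ R⊆M) (m#R ∷ R!) cross =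
    by-cases (a ∈ᵥ? A) (b ∈ᵥ? avoid a A)
    where
      open ≤-Reasoning
      A₀ = avoid b (avoid a A)
      A! = Matching.pairwise A-m

      by-induction : ∀ {N} → Matching G N → All (_∈ N) R →
                     (∀ {e y} → e ∈ A₀ → y ∈ₑ e → ¬ y ∈ᵥ M → ¬ y ∈ᵥ N) →
                     length M + length A ≤ suc (length N + length A₀) →
                     length M + length A ≤ μ G + suc (length R)
      by-induction {N} N-m R⊆N keep le = begin
        length M + length A        ≤⟨ le ⟩
        suc (length N + length A₀) ≤⟨ s≤s (crossing-matching-bound R N-m (avoid-matching (avoid-matching A-m))
                                                                      R⊆N R! (avoid₂-crossing cross keep)) ⟩
        suc (μ G + length R)       ≡⟨ +-suc _ _ ⟨
        μ G + suc (length R)       ∎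

      at-most-one-covered : length A ≤ suc (length A₀) → length M + length A ≤ μ G + suc (length R)
      at-most-one-covered le =
        by-induction M-m R⊆M (λ _ _ y∉ → y∉)
          (≤-trans (+-monoʳ-≤ (length M) le) (≤-reflexive (+-suc (length M) _)))

      both-covered : length M + length A ≤ suc (suc (suc (length (avoid a M))) + length A₀)
      both-covered = begin
        length M + length A
          ≤⟨ +-mono-≤ (length-avoid (Matching.pairwise M-m))
                      (≤-trans (length-avoid A!)
                               (s≤s (length-avoid (Matching.pairwise (avoid-matching A-m))))) ⟩
        suc (length (avoid a M)) + suc (suc (length A₀))
          ≡⟨ cong suc (trans (+-suc _ (suc (length A₀))) (cong suc (+-suc _ (length A₀)))) ⟩
        suc (suc (suc (length (avoid a M))) + length A₀) ∎

      by-cases : Dec (a ∈ᵥ A) → Dec (b ∈ᵥ avoid a A) → length M + length A ≤ μ G + suc (length R)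
      by-cases (no a∉A)  _          = at-most-one-covered
        (≤-trans (length-avoid-∉ a∉A) (length-avoid (Matching.pairwise (avoid-matching A-m))))
      by-cases (yes _)   (no b∉A₁)  = at-most-one-covered
        (≤-trans (length-avoid A!) (s≤s (length-avoid-∉ b∉A₁)))
      by-cases (yes a∈A) (yes b∈A₁) =
        let _ , e₁∈A , a∈e₁ = find a∈A ; _ , e₂∈A₁ , b∈e₂ = find b∈A₁ in
        by-induction (augment M-m m∈M A-m cross e₁∈A a∈e₁ e₂∈A₁ b∈e₂)
          (All.tabulate λ r∈ →
            there (there (∈-avoid⁺ (All.lookup R⊆M r∈) (All.lookup m#R r∈ (inj₁ refl)))))
          (augment-uncovered A! e₁∈A a∈e₁ (proj₁ (∈-avoid⁻ A e₂∈A₁)) b∈e₂)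
          both-covered

  GMM-bound : ∀ {G M R π} → IsMatching G M → R ⊆ M → π ∈ permutations (crossEdges G M R) →
              length M + length (GMM π) ≤ μ G + length R
  GMM-bound {G} {M} {R} {π} M-is-matching R⊆M π∈ =
    crossing-matching-bound R M-m (mkMatching (All.map proj₁ GMM-cross) (GMM-pairwise π))
      (All-resp-⊆ R⊆M (All.tabulate id)) (AllPairs-resp-⊆ R⊆M (Matching.pairwise M-m)) (All.map proj₂ GMM-cross)
    where
      M-m = IsMatching⇒Matching M-is-matching
      GMM-cross : All (λ e → e ∈ edges G × Crossing M R e) (GMM π)
      GMM-cross = All.tabulate (∈-crossEdges {G = G} ∘ ∈-resp-↭ (permutations-↭ _ π∈) ∘ GMM-⊆ π)

fromℚᵘ-mono-≤ : ∀ {p q} → p ℚᵘ.≤ q → ℚ.fromℚᵘ p ℚ.≤ ℚ.fromℚᵘ q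
fromℚᵘ-mono-≤ {p} {q} p≤q = ℚₚ.toℚᵘ-cancel-≤ (begin
  ℚ.toℚᵘ (ℚ.fromℚᵘ p) ≃⟨ ℚₚ.toℚᵘ-fromℚᵘ p ⟩
  p                   ≤⟨ p≤q ⟩
  q                   ≃⟨ ℚₚ.toℚᵘ-fromℚᵘ q ⟨
  ℚ.toℚᵘ (ℚ.fromℚᵘ q) ∎)
  where open ℚᵘₚ.≤-Reasoning

-- toℚ k and average (x ∷ xs) both unfold to fractions (+ a) / suc b.
ℕ-/-mono-≤ : ∀ a b c d → a ℕ.* suc d ≤ c ℕ.* suc b → (+ a) ℚ./ suc b ℚ.≤ (+ c) ℚ./ suc d
ℕ-/-mono-≤ a b c d le = fromℚᵘ-mono-≤ {ℚᵘ.mkℚᵘ (+ a) b} {ℚᵘ.mkℚᵘ (+ c) d}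
  (ℚᵘ.*≤* (subst₂ ℤ._≤_ (ℤₚ.pos-* a (suc d)) (ℤₚ.pos-* c (suc b)) (ℤ.+≤+ le)))

toℚ-mono-≤ : ∀ {j k} → j ≤ k → toℚ j ℚ.≤ toℚ k
toℚ-mono-≤ {j} {k} j≤k = ℕ-/-mono-≤ j 0 k 0 (ℕₚ.*-monoˡ-≤ 1 j≤k)

toℚ-+ : ∀ j k → toℚ (j + k) ≡ toℚ j ℚ.+ toℚ k
toℚ-+ j k = ℚₚ.toℚᵘ-injective (begin-equality
  ℚ.toℚᵘ (toℚ (j + k))                 ≃⟨ ℚₚ.toℚᵘ-fromℚᵘ (ℕ→ℚᵘ (j + k)) ⟩
  ℕ→ℚᵘ (j + k)                         ≃⟨ ℚᵘ.*≡* (cong (ℤ._* ℤ.1ℤ) (sym (cong₂ ℤ._+_ (ℤₚ.*-identityʳ (+ j))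
                                                                                   (ℤₚ.*-identityʳ (+ k))))) ⟩
  ℕ→ℚᵘ j ℚᵘ.+ ℕ→ℚᵘ k                   ≃⟨ ℚᵘₚ.+-cong (ℚₚ.toℚᵘ-fromℚᵘ (ℕ→ℚᵘ j)) (ℚₚ.toℚᵘ-fromℚᵘ (ℕ→ℚᵘ k)) ⟨
  ℚ.toℚᵘ (toℚ j) ℚᵘ.+ ℚ.toℚᵘ (toℚ k)   ≃⟨ ℚₚ.toℚᵘ-homo-+ (toℚ j) (toℚ k) ⟨
  ℚ.toℚᵘ (toℚ j ℚ.+ toℚ k)             ∎)
  where
    open ℚᵘₚ.≤-Reasoning
    ℕ→ℚᵘ : ℕ → ℚᵘ.ℚᵘ
    ℕ→ℚᵘ k = ℚᵘ.mkℚᵘ (+ k) 0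

sum-≤ : ∀ {k xs} → All (_≤ k) xs → sum xs ≤ length xs ℕ.* k
sum-≤ []            = z≤n
sum-≤ (x≤k ∷ xs≤k) = +-mono-≤ x≤k (sum-≤ xs≤k)

average-≤ : ∀ {k xs} → All (_≤ k) xs → average xs ℚ.≤ toℚ k
average-≤ {k} []                = toℚ-mono-≤ {0} {k} z≤n
average-≤ {k} {x ∷ xs} xs≤k = ℕ-/-mono-≤ (sum (x ∷ xs)) (length xs) k 0 (begin
  sum (x ∷ xs) ℕ.* 1        ≡⟨ ℕₚ.*-identityʳ _ ⟩
  sum (x ∷ xs)              ≤⟨ sum-≤ xs≤k ⟩
  suc (length xs) ℕ.* k     ≡⟨ ℕₚ.*-comm (suc (length xs)) k ⟩
  k ℕ.* suc (length xs)     ∎)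
  where open ≤-Reasoning

estimate-≤ : ∀ {a b c g} → a ≤ c → g ℚ.≤ toℚ (c + b ∸ a) → toℚ a ℚ.+ (ℚ.0ℚ ℚ.⊔ (g ℚ.- toℚ b)) ℚ.≤ toℚ c
estimate-≤ {a} {b} {c} {g} a≤c g≤ with ℚₚ.⊔-sel ℚ.0ℚ (g ℚ.- toℚ b)
... | inj₁ eq rewrite eq | ℚₚ.+-identityʳ (toℚ a) = toℚ-mono-≤ a≤c
... | inj₂ eq rewrite eq = begin
  toℚ a ℚ.+ (g ℚ.- toℚ b)               ≤⟨ ℚₚ.+-monoʳ-≤ (toℚ a) (ℚₚ.+-monoˡ-≤ (ℚ.- toℚ b) g≤) ⟩
  toℚ a ℚ.+ (toℚ (c + b ∸ a) ℚ.- toℚ b) ≡⟨ ℚₚ.+-assoc (toℚ a) _ _ ⟨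
  toℚ a ℚ.+ toℚ (c + b ∸ a) ℚ.- toℚ b   ≡⟨ cong (ℚ._- toℚ b) (trans (sym (toℚ-+ a _)) (cong toℚ a+[c+b∸a]≡c+b)) ⟩
  toℚ (c + b) ℚ.- toℚ b                 ≡⟨ cong (ℚ._- toℚ b) (toℚ-+ c b) ⟩
  toℚ c ℚ.+ toℚ b ℚ.- toℚ b             ≡⟨ ℚₚ.+-assoc (toℚ c) (toℚ b) _ ⟩
  toℚ c ℚ.+ (toℚ b ℚ.- toℚ b)           ≡⟨ cong (toℚ c ℚ.+_) (ℚₚ.+-inverseʳ (toℚ b)) ⟩
  toℚ c ℚ.+ ℚ.0ℚ                        ≡⟨ ℚₚ.+-identityʳ (toℚ c) ⟩
  toℚ c                                 ∎
  where
    open ℚₚ.≤-Reasoning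
    a+[c+b∸a]≡c+b = ℕₚ.m+[n∸m]≡n (≤-trans a≤c (ℕₚ.m≤m+n c b))

lemma4p8 : ∀ {n} (G : Graph n) → IsBipartite G →
    (M : List (Edge n)) → IsMaximalMatching G M →
    (M' : List (Edge n)) → M' ⊆ M →
    μ̃' G M M' ℚ.≤ toℚ (μ G)
lemma4p8 G _ M M-maximal M' M'⊆M =
  estimate-≤ (Matching⇒≤μ (IsMatching⇒Matching M-matching)) (average-≤ (Allₚ.map⁺ (All.tabulate GMM-≤)))
  where
    M-matching = IsMaximalMatching.matching M-maximal
    GMM-≤ : ∀ {π} → π ∈ permutations (crossEdges G M M') → length (GMM π) ≤ μ G + length M' ∸ length M
    GMM-≤ {π} π∈ = ℕₚ.m+n≤o⇒m≤o∸n (length (GMM π))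
      (subst (_≤ μ G + length M') (ℕₚ.+-comm (length M) _) (GMM-bound M-matching M'⊆M π∈))
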